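{- Let $p\ge 3$ be an odd prime and $r\ge 2$ an integer, write $p^{2r}+1=b^2D$ with $b$ a positive integer and $D$ square-free, and let $K=\mathbb{Q}(\sqrt{D})$. Let $\mathfrak{p}$ be the prime ideal of $\mathcal{O}_K$ above $p$ such that $(b\sqrt{D}-1)\mathcal{O}_K=\mathfrak{p}^{2r}$. Then \[ (b\sqrt{D}+1)^{p-1}\equiv 2^{p-1}\pmod{\mathfrak{p}^2}. \] -}

module Defs where

open import Data.Nat as ℕ using (ℕ; zero; suc; _%_; _/_)
open import Data.Nat.Divisibility using (_∣_)
open import Data.Integer as ℤ using (ℤ; +_; -_)
open import Data.Product using (_×_; _,_; ∃; Σ)
open import Data.List using (List; []; _∷_)
open import Data.List.Relation.Unary.All using (All)
open import Data.Bool using (if_then_else_)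
open import Relation.Nullary.Decidable using (⌊_⌋)
open import Relation.Binary.PropositionalEquality using (_≡_)
open import Data.Sum using (_⊎_)
open import Relation.Nullary using (¬_)

SquareFree : ℕ → Set
SquareFree D = ∀ (m : ℕ) → m ℕ.* m ∣ D → m ≡ 1

-- The ring of integers O_K of K = ℚ(√D), for square-free D ≠ 1:
-- O_K = ℤ[ω] with ω = (1+√D)/2 if D ≡ 1 (mod 4) and ω = √D otherwise.
-- An element (x , y) represents x + y ω.

OK : Set
OK = ℤ × ℤ

infixl 6 _⊕_ _⊖_
_⊕_ : OK → OK → OK
(a , b) ⊕ (c , d) = (a ℤ.+ c , b ℤ.+ d)
_⊖_ : OK → OK → OK
(a , b) ⊖ (c , d) = (a ℤ.- c , b ℤ.- d)

module _ (D : ℕ) where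

  private
    one-mod-4 = ⌊ D % 4 ℕ.≟ 1 ⌋

  ω² : ℤ × ℤ
  ω² = if one-mod-4 then (+ (D / 4) , + 1) else (+ D , + 0)

  √D : OK
  √D = if one-mod-4 then (- + 1 , + 2) else (+ 0 , + 1)

  infixl 7 _·_
  _·_ : OK → OK → OK
  (a , b) · (c , d) with ω²
  ... | (c₀ , c₁) = (a ℤ.* c ℤ.+ b ℤ.* d ℤ.* c₀ , a ℤ.* d ℤ.+ b ℤ.* c ℤ.+ b ℤ.* d ℤ.* c₁)

  pow : OK → ℕ → OK
  pow x zero    = (+ 1 , + 0)
  pow x (suc n) = x · pow x n

  Subset : Set₁
  Subset = OK → Set

  IsIdeal : Subset → Set
  IsIdeal I = I (+ 0 , + 0)
            × (∀ x y → I x → I y → I (x ⊕ y))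
            × (∀ r x → I x → I (r · x))

  IsPrimeIdeal : Subset → Set
  IsPrimeIdeal P = IsIdeal P
                 × ¬ P (+ 1 , + 0)
                 × (∀ x y → P (x · y) → P x ⊎ P y)

  ⟨_⟩ : OK → Subset
  ⟨ x ⟩ y = ∃ λ z → y ≡ z · x

  sumProd : List (OK × OK) → OK
  sumProd []             = (+ 0 , + 0)
  sumProd ((a , b) ∷ ps) = (a · b) ⊕ sumProd ps

  _⊗_ : Subset → Subset → Subset
  (I ⊗ J) y = Σ (List (OK × OK)) λ ps →
                All (λ ab → I (Data.Product.proj₁ ab) × J (Data.Product.proj₂ ab)) ps
              × y ≡ sumProd ps

  _^ᴵ_ : Subset → ℕ → Subset
  I ^ᴵ zero  = ⟨ (+ 1 , + 0) ⟩
  I ^ᴵ suc n = I ⊗ (I ^ᴵ n)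

  _≐_ : Subset → Subset → Set
  I ≐ J = (∀ x → I x → J x) × (∀ x → J x → I x)

  Cong : Subset → OK → OK → Set
  Cong I x y = I (x ⊖ y)


ι : ℕ → OK
ι n = (+ n , + 0)

scale : ℕ → OK → OK
scale n (a , b) = (+ n ℤ.* a , + n ℤ.* b)

-- With α = b√D − 1 we have b√D + 1 = α + 2, and (α + t)ⁿ ≡ tⁿ modulo α by
-- induction on n, so (b√D + 1)^(p−1) − 2^(p−1) lies in αO_K = 𝔭^(2r) ⊆ 𝔭².
module Submission where

open import Defs
open import Data.Nat using (ℕ; zero; suc; _+_; _*_; _^_; _∸_; _≤_; z≤n; s≤s)
open import Data.Nat.Primality using (Prime)
open import Data.Nat.Properties using (*-monoʳ-≤; <⇒≤)
open import Data.Integer as ℤ using (ℤ; +_)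
import Data.Integer.Properties as ℤ
open import Data.Integer.Tactic.RingSolver using (solve; solve-∀)
open import Data.List using ([]; _∷_)
open import Data.Product using (_,_; proj₁; proj₂; ∃; map₂)
import Data.List.Relation.Unary.All as All
open import Relation.Binary.PropositionalEquality using (_≡_; sym; trans; cong; cong₂; subst; module ≡-Reasoning)

⊕-assoc : ∀ x y z → (x ⊕ y) ⊕ z ≡ x ⊕ (y ⊕ z)
⊕-assoc (a , b) (c , d) (e , f) = cong₂ _,_ (ℤ.+-assoc a c e) (ℤ.+-assoc b d f)

⊕-identityˡ : ∀ x → (+ 0 , + 0) ⊕ x ≡ x
⊕-identityˡ (a , b) = cong₂ _,_ (ℤ.+-identityˡ a) (ℤ.+-identityˡ b)

⊕-⊖-cancelʳ : ∀ x y → (x ⊕ y) ⊖ y ≡ x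
⊕-⊖-cancelʳ (a , b) (c , d) = cong₂ _,_ (cancel a c) (cancel b d)
  where
  cancel : ∀ i j → i ℤ.+ j ℤ.- j ≡ i
  cancel = solve-∀

⊕-ι1≡⊖-ι1-⊕-ι2 : ∀ x → x ⊕ ι 1 ≡ (x ⊖ ι 1) ⊕ ι 2
⊕-ι1≡⊖-ι1-⊕-ι2 (a , b) = cong₂ _,_ (shift a) (shift′ b)
  where
  shift : ∀ i → i ℤ.+ + 1 ≡ (i ℤ.- + 1) ℤ.+ + 2
  shift = solve-∀
  shift′ : ∀ i → i ℤ.+ + 0 ≡ (i ℤ.- + 0) ℤ.+ + 0
  shift′ = solve-∀

-- Multiplication in ℤ[ω] for ω² = c₀ + c₁ω; for (c₀ , c₁) = ω² D this is
-- definitionally the product _·_ D of O_K.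
module QuadraticMultiplication (c₀ c₁ : ℤ) where

  infixl 7 _∙_
  _∙_ : OK → OK → OK
  (a , b) ∙ (c , d) = (a ℤ.* c ℤ.+ b ℤ.* d ℤ.* c₀ , a ℤ.* d ℤ.+ b ℤ.* c ℤ.+ b ℤ.* d ℤ.* c₁)

  ∙-comm : ∀ x y → x ∙ y ≡ y ∙ x
  ∙-comm (a , b) (c , d) =
    cong₂ _,_ (solve (a ∷ b ∷ c ∷ d ∷ c₀ ∷ [])) (solve (a ∷ b ∷ c ∷ d ∷ c₁ ∷ []))

  ∙-identityʳ : ∀ x → x ∙ ι 1 ≡ x
  ∙-identityʳ (a , b) = cong₂ _,_ (solve (a ∷ b ∷ c₀ ∷ [])) (solve (a ∷ b ∷ c₁ ∷ []))

  ∙-zeroˡ : ∀ x → (+ 0 , + 0) ∙ x ≡ (+ 0 , + 0)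
  ∙-zeroˡ (a , b) = cong₂ _,_ (solve (a ∷ b ∷ c₀ ∷ [])) (solve (a ∷ b ∷ c₁ ∷ []))

  ι-∙-ι : ∀ m n → ι m ∙ ι n ≡ ι (m * n)
  ι-∙-ι m n = trans (cong₂ _,_ (product (+ m) (+ n)) (vanish (+ m) (+ n)))
                    (cong (_, + 0) (sym (ℤ.pos-* m n)))
    where
    product : ∀ i j → i ℤ.* j ℤ.+ + 0 ℤ.* + 0 ℤ.* c₀ ≡ i ℤ.* j
    product = solve-∀
    vanish : ∀ i j → i ℤ.* + 0 ℤ.+ + 0 ℤ.* j ℤ.+ + 0 ℤ.* + 0 ℤ.* c₁ ≡ + 0
    vanish = solve-∀

  ∙-distribˡ-⊕ : ∀ x y z → x ∙ (y ⊕ z) ≡ x ∙ y ⊕ x ∙ z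
  ∙-distribˡ-⊕ (a , b) (c , d) (e , f) =
    cong₂ _,_ (first a b c d e f c₀) (second a b c d e f c₁)
    where
    first : ∀ a b c d e f c₀ →
      a ℤ.* (c ℤ.+ e) ℤ.+ b ℤ.* (d ℤ.+ f) ℤ.* c₀
        ≡ (a ℤ.* c ℤ.+ b ℤ.* d ℤ.* c₀) ℤ.+ (a ℤ.* e ℤ.+ b ℤ.* f ℤ.* c₀)
    first = solve-∀
    second : ∀ a b c d e f c₁ →
      a ℤ.* (d ℤ.+ f) ℤ.+ b ℤ.* (c ℤ.+ e) ℤ.+ b ℤ.* (d ℤ.+ f) ℤ.* c₁
        ≡ (a ℤ.* d ℤ.+ b ℤ.* c ℤ.+ b ℤ.* d ℤ.* c₁) ℤ.+ (a ℤ.* f ℤ.+ b ℤ.* e ℤ.+ b ℤ.* f ℤ.* c₁)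
    second = solve-∀

  ∙-distribʳ-⊕ : ∀ x y z → (x ⊕ y) ∙ z ≡ x ∙ z ⊕ y ∙ z
  ∙-distribʳ-⊕ x y z = begin
    (x ⊕ y) ∙ z    ≡⟨ ∙-comm (x ⊕ y) z ⟩
    z ∙ (x ⊕ y)    ≡⟨ ∙-distribˡ-⊕ z x y ⟩
    z ∙ x ⊕ z ∙ y  ≡⟨ cong₂ _⊕_ (∙-comm z x) (∙-comm z y) ⟩
    x ∙ z ⊕ y ∙ z  ∎
    where open ≡-Reasoning

  ∙-assoc : ∀ x y z → (x ∙ y) ∙ z ≡ x ∙ (y ∙ z)
  ∙-assoc (a , b) (c , d) (e , f) =
    cong₂ _,_ (first a b c d e f c₀ c₁) (second a b c d e f c₀ c₁)
    where
    first : ∀ a b c d e f c₀ c₁ →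
      (a ℤ.* c ℤ.+ b ℤ.* d ℤ.* c₀) ℤ.* e ℤ.+ (a ℤ.* d ℤ.+ b ℤ.* c ℤ.+ b ℤ.* d ℤ.* c₁) ℤ.* f ℤ.* c₀
        ≡ a ℤ.* (c ℤ.* e ℤ.+ d ℤ.* f ℤ.* c₀) ℤ.+ b ℤ.* (c ℤ.* f ℤ.+ d ℤ.* e ℤ.+ d ℤ.* f ℤ.* c₁) ℤ.* c₀
    first = solve-∀
    second : ∀ a b c d e f c₀ c₁ →
      (a ℤ.* c ℤ.+ b ℤ.* d ℤ.* c₀) ℤ.* f ℤ.+ (a ℤ.* d ℤ.+ b ℤ.* c ℤ.+ b ℤ.* d ℤ.* c₁) ℤ.* e
        ℤ.+ (a ℤ.* d ℤ.+ b ℤ.* c ℤ.+ b ℤ.* d ℤ.* c₁) ℤ.* f ℤ.* c₁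
        ≡ a ℤ.* (c ℤ.* f ℤ.+ d ℤ.* e ℤ.+ d ℤ.* f ℤ.* c₁) ℤ.+ b ℤ.* (c ℤ.* e ℤ.+ d ℤ.* f ℤ.* c₀)
          ℤ.+ b ℤ.* (c ℤ.* f ℤ.+ d ℤ.* e ℤ.+ d ℤ.* f ℤ.* c₁) ℤ.* c₁
    second = solve-∀

module _ (D : ℕ) where
  open QuadraticMultiplication (proj₁ (ω² D)) (proj₂ (ω² D))

  pow-⊕-ι : ∀ α t n → ∃ λ z → pow D (α ⊕ ι t) n ≡ z ∙ α ⊕ ι (t ^ n)
  pow-⊕-ι α t zero =
    (+ 0 , + 0) , sym (trans (cong (_⊕ ι 1) (∙-zeroˡ α)) (⊕-identityˡ (ι 1)))
  pow-⊕-ι α t (suc n) with pow-⊕-ι α t n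
  ... | z , βⁿ≡zα+tⁿ = β ∙ z ⊕ ι s , (begin
    β ∙ pow D β n                          ≡⟨ cong (β ∙_) βⁿ≡zα+tⁿ ⟩
    β ∙ (z ∙ α ⊕ ι s)                      ≡⟨ ∙-distribˡ-⊕ β (z ∙ α) (ι s) ⟩
    β ∙ (z ∙ α) ⊕ β ∙ ι s                  ≡⟨ cong₂ _⊕_ (sym (∙-assoc β z α)) (∙-distribʳ-⊕ α (ι t) (ι s)) ⟩
    (β ∙ z) ∙ α ⊕ (α ∙ ι s ⊕ ι t ∙ ι s)    ≡⟨ sym (⊕-assoc ((β ∙ z) ∙ α) (α ∙ ι s) (ι t ∙ ι s)) ⟩
    (β ∙ z) ∙ α ⊕ α ∙ ι s ⊕ ι t ∙ ι s      ≡⟨ cong₂ (λ u v → (β ∙ z) ∙ α ⊕ u ⊕ v) (∙-comm α (ι s)) (ι-∙-ι t s) ⟩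
    (β ∙ z) ∙ α ⊕ ι s ∙ α ⊕ ι (t * s)      ≡⟨ cong (_⊕ ι (t * s)) (sym (∙-distribʳ-⊕ (β ∙ z) (ι s) α)) ⟩
    (β ∙ z ⊕ ι s) ∙ α ⊕ ι (t * s)          ∎)
    where
    open ≡-Reasoning
    β = α ⊕ ι t
    s = t ^ n

  pow-⊕-ι-≡-mod : ∀ α t n → Cong D (⟨_⟩ D α) (pow D (α ⊕ ι t) n) (ι (t ^ n))
  pow-⊕-ι-≡-mod α t n with pow-⊕-ι α t n
  ... | z , eq = z , trans (cong (_⊖ ι (t ^ n)) eq) (⊕-⊖-cancelʳ (z ∙ α) (ι (t ^ n)))

  ^ᴵ-antimono : ∀ (I : Subset D) {m n} → m ≤ n → ∀ x → _^ᴵ_ D I n x → _^ᴵ_ D I m x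
  ^ᴵ-antimono I z≤n       x _                   = x , sym (∙-identityʳ x)
  ^ᴵ-antimono I (s≤s m≤n) x (ps , I×Iⁿ , x≡Σps) =
    ps , All.map (map₂ (^ᴵ-antimono I m≤n _)) I×Iⁿ , x≡Σps

-- Only the factorisation (b√D − 1) = 𝔭^(2r) and r ≥ 1 are needed.
lemma4p3 : (p r b D : ℕ) → Prime p → 3 ≤ p → 2 ≤ r → 1 ≤ b
         → SquareFree D → p ^ (2 * r) + 1 ≡ b * b * D
         → (𝔭 : Subset D) → IsPrimeIdeal D 𝔭 → 𝔭 (ι p)
         → _≐_ D (⟨_⟩ D (scale b (√D D) ⊖ ι 1)) (_^ᴵ_ D 𝔭 (2 * r))
         → Cong D (_^ᴵ_ D 𝔭 2) (pow D (scale b (√D D) ⊕ ι 1) (p ∸ 1)) (ι (2 ^ (p ∸ 1)))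
lemma4p3 p r b D _ _ 2≤r _ _ _ 𝔭 _ _ (⟨α⟩⊆𝔭²ʳ , _) =
  ^ᴵ-antimono D 𝔭 2≤2r _ (⟨α⟩⊆𝔭²ʳ _ βᵖ⁻¹≡2ᵖ⁻¹-mod-α)
  where
  α β : OK
  α = scale b (√D D) ⊖ ι 1
  β = scale b (√D D) ⊕ ι 1

  2≤2r : 2 ≤ 2 * r
  2≤2r = *-monoʳ-≤ 2 (<⇒≤ 2≤r)

  βᵖ⁻¹≡2ᵖ⁻¹-mod-α : Cong D (⟨_⟩ D α) (pow D β (p ∸ 1)) (ι (2 ^ (p ∸ 1)))
  βᵖ⁻¹≡2ᵖ⁻¹-mod-α = subst (λ γ → Cong D (⟨_⟩ D α) (pow D γ (p ∸ 1)) (ι (2 ^ (p ∸ 1))))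
                          (sym (⊕-ι1≡⊖-ι1-⊕-ι2 (scale b (√D D))))
                          (pow-⊕-ι-≡-mod D α 2 (p ∸ 1))
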